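{- Let $D\in k[t]$ be negative and square-free of odd degree. If $Q=(a,b,c)\in\mathcal Q_D$, then $Q|M\in\mathcal Q_D$ for every $M\in\mathrm{SL}_2(k[t])$. In particular, every $n\in k[t]$ properly represented by $Q$ is positive.
   Context: $k$ is a number field. A polynomial $n\in k[t]$ is positive if $n\neq0$ and the leading coefficient of $(-1)^{\deg n}n$ lies in $(k^\times)^2$; negative if $-n$ is positive. A form $(a,b,c)$ denotes $ax^2+2bxy+cy^2$ with discriminant $b^2-ac$; it properly represents $n$ if $n=Q(x,y)$ with coprime $x,y\in k[t]$. $\mathcal Q_D$ is the set of forms over $k[t]$ of discriminant $D$ with $a$ positive. For $M=\begin{pmatrix} m&r\\ n&s\end{pmatrix}$, $Q|M(x,y)=Q(mx+ny,rx+sy)$. -}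

module Defs where

open import Level using (0ℓ)
open import Algebra.Bundles using (CommutativeRing)
open import Data.Nat using (ℕ; zero; suc; _<_) renaming (_+_ to _+ℕ_; _*_ to _*ℕ_)
open import Data.Fin as Fin using (Fin)
open import Data.List using (List; []; _∷_; map)
open import Data.Product using (Σ; ∃; ∃-syntax; Σ-syntax; _×_; _,_)
open import Data.Rational as ℚ using (ℚ)
open import Relation.Nullary using (¬_)
open import Relation.Binary.PropositionalEquality using (_≡_)

sumF : (R : CommutativeRing 0ℓ 0ℓ) → (n : ℕ) → (Fin n → CommutativeRing.Carrier R)
       → CommutativeRing.Carrier R
sumF R zero    f = CommutativeRing.0# R
sumF R (suc n) f = CommutativeRing._+_ R (f Fin.zero) (sumF R n (λ i → f (Fin.suc i)))

record NumberField : Set₁ where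
  field
    baseRing : CommutativeRing 0ℓ 0ℓ
  open CommutativeRing baseRing public

  field
    0≉1   : ¬ (0# ≈ 1#)
    inv   : ∀ x → ¬ (x ≈ 0#) → ∃[ y ] (x * y ≈ 1#)
    ι     : ℚ → Carrier
    ι-1   : ι ℚ.1ℚ ≈ 1#
    ι-+   : ∀ p q → ι (p ℚ.+ q) ≈ ι p + ι q
    ι-*   : ∀ p q → ι (p ℚ.* q) ≈ ι p * ι q
    dim   : ℕ
    basis : Fin dim → Carrier
    span  : ∀ x → Σ[ c ∈ (Fin dim → ℚ) ] (x ≈ sumF baseRing dim (λ i → ι (c i) * basis i))
    indep : ∀ (c : Fin dim → ℚ) → sumF baseRing dim (λ i → ι (c i) * basis i) ≈ 0#
              → ∀ i → c i ≡ ℚ.0ℚ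

module PolyOver (k : NumberField) where
  open NumberField k

  -- polynomials as coefficient lists, constant term first
  Poly : Set
  Poly = List Carrier

  coeff : Poly → ℕ → Carrier
  coeff []       _       = 0#
  coeff (x ∷ p)  zero    = x
  coeff (x ∷ p)  (suc i) = coeff p i

  -- equality of polynomials (coefficientwise, trailing zeros irrelevant)
  infix 4 _≈ₚ_
  _≈ₚ_ : Poly → Poly → Set
  p ≈ₚ q = ∀ i → coeff p i ≈ coeff q i

  0ₚ 1ₚ : Poly
  0ₚ = []
  1ₚ = 1# ∷ []

  const : Carrier → Poly
  const c = c ∷ []

  infixl 6 _+ₚ_ _-ₚ_
  infixl 7 _*ₚ_ _·ₚ_
  _+ₚ_ : Poly → Poly → Poly
  []      +ₚ q       = q
  (x ∷ p) +ₚ []      = x ∷ p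
  (x ∷ p) +ₚ (y ∷ q) = (x + y) ∷ (p +ₚ q)

  -ₚ_ : Poly → Poly
  -ₚ p = map -_ p

  _-ₚ_ : Poly → Poly → Poly
  p -ₚ q = p +ₚ (-ₚ q)

  _·ₚ_ : Carrier → Poly → Poly
  c ·ₚ p = map (c *_) p

  _*ₚ_ : Poly → Poly → Poly
  []      *ₚ q = []
  (x ∷ p) *ₚ q = (x ·ₚ q) +ₚ (0# ∷ (p *ₚ q))

  twoₚ : Poly
  twoₚ = const (1# + 1#)

  HasLead : Poly → ℕ → Carrier → Set
  HasLead p d l = (coeff p d ≈ l) × ¬ (l ≈ 0#) × (∀ i → d < i → coeff p i ≈ 0#)

  Deg : Poly → ℕ → Set
  Deg p d = ∃[ l ] HasLead p d l

  negPow : ℕ → Carrier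
  negPow zero    = 1#
  negPow (suc d) = - negPow d

  IsNonzeroSquare : Carrier → Set
  IsNonzeroSquare l = ∃[ u ] (¬ (u ≈ 0#) × (u * u ≈ l))

  Positive : Poly → Set
  Positive n = ¬ (n ≈ₚ 0ₚ) ×
    ∃[ d ] (Deg n d × ∃[ l ] (HasLead (negPow d ·ₚ n) d l × IsNonzeroSquare l))

  Negative : Poly → Set
  Negative n = Positive (-ₚ n)

  Odd : ℕ → Set
  Odd d = ∃[ m ] (d ≡ suc (2 *ℕ m))

  OddDegree : Poly → Set
  OddDegree n = ∃[ d ] (Deg n d × Odd d)

  _∣ₚ_ : Poly → Poly → Set
  d ∣ₚ x = ∃[ e ] (d *ₚ e ≈ₚ x)

  Unit : Poly → Set
  Unit u = ∃[ e ] (u *ₚ e ≈ₚ 1ₚ)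

  Coprime : Poly → Poly → Set
  Coprime x y = ∀ d → d ∣ₚ x → d ∣ₚ y → Unit d

  SquareFree : Poly → Set
  SquareFree D = ∀ p → (p *ₚ p) ∣ₚ D → Unit p

  record Form : Set where
    constructor form
    field
      a b c : Poly

  eval : Form → Poly → Poly → Poly
  eval (form a b c) x y = a *ₚ x *ₚ x +ₚ twoₚ *ₚ b *ₚ x *ₚ y +ₚ c *ₚ y *ₚ y

  disc : Form → Poly
  disc (form a b c) = b *ₚ b -ₚ a *ₚ c

  In𝒬 : Poly → Form → Set
  In𝒬 D Q = (disc Q ≈ₚ D) × Positive (Form.a Q)

  -- M = ( m r ; n s ) ∈ SL₂(k[t])
  record SL₂ : Set where
    constructor mat
    field
      m r n s : Poly
      det≡1   : m *ₚ s -ₚ r *ₚ n ≈ₚ 1ₚ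

  -- Q|M (x,y) = Q(m x + n y, r x + s y)
  _∣_ : Form → SL₂ → Form
  form a b c ∣ mat m r n s _ =
    form (eval (form a b c) m r)
         (a *ₚ m *ₚ n +ₚ b *ₚ (m *ₚ s +ₚ r *ₚ n) +ₚ c *ₚ r *ₚ s)
         (eval (form a b c) n s)

  ProperlyRepresents : Form → Poly → Set
  ProperlyRepresents Q n = ∃[ x ] ∃[ y ] (Coprime x y × (eval Q x y ≈ₚ n))

-- Completing the square gives  a · Q(x,y) = (a x + b y)² + (−D) y².  A nonzero square is
-- positive of even degree, and (−D) y² with y ≠ 0 is positive of odd degree because −D is;
-- positive polynomials of different degrees add to a positive one, so the right-hand side
-- is positive whenever (x,y) ≠ (0,0).  Since a is positive and positivity is multiplicative
-- and cancellable, Q(x,y) is positive.  Finally disc (Q|M) = det(M)² · disc Q, the first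
-- column of M ∈ SL₂ is nonzero, and a coprime pair is nonzero.
module Submission where

open import Defs
open import Level using (Level; 0ℓ)
open import Algebra.Bundles using (CommutativeRing; AbelianGroup)
open import Algebra.Solver.Ring.AlmostCommutativeRing using (fromCommutativeRing; _-Raw-AlmostCommutative⟶_)
import Algebra.Solver.Ring as RingSolver
open import Data.Empty using (⊥-elim)
open import Data.Fin.Base using (Fin)
open import Data.Fin.Properties using (all?)
open import Data.Integer.Base as ℤ using (ℤ; +_; -[1+_]; _⊖_; _◃_; ∣_∣; sign)
open import Data.Integer.Properties as ℤ using ([1+m]⊖[1+n]≡m⊖n)
open import Data.List.Base using ([]; _∷_)
open import Data.Maybe.Base using (Maybe; just; nothing)
open import Data.Nat.Base as ℕ using (ℕ; zero; suc; _≤_; s≤s; z≤n)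
open import Data.Nat.Properties using (+-suc; <-cmp; ≤-refl; <-≤-trans; <⇒≤; m≤n+m; even≢odd)
open import Data.Nat.Tactic.RingSolver using (solve-∀)
open import Data.Product using (_×_; _,_; ∃-syntax; proj₁; proj₂)
import Data.Rational.Base as ℚ
import Data.Rational.Properties as ℚ
open import Data.Sign.Base as Sign using (Sign)
open import Data.Sum.Base using (_⊎_; inj₁; inj₂)
open import Relation.Binary.Definitions using (tri<; tri≈; tri>)
open import Relation.Binary.PropositionalEquality as ≡ using (_≡_; _≢_; cong)
open import Relation.Nullary using (¬_; Dec; yes; no)

-- The carrier of an arbitrary commutative ring has no decidable equality to normalise
-- coefficients with, so the solver takes them from ℤ through its canonical map into R.
module IntegerCoefficientSolver {c ℓ : Level} (R : CommutativeRing c ℓ) where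
  open CommutativeRing R
  open import Algebra.Properties.Ring ring using (-0#≈0#; -‿involutive; -‿anti-homo-+; -1*x≈-x)
  open import Algebra.Properties.CommutativeSemigroup +-commutativeSemigroup using (interchange)
  open import Algebra.Properties.Semiring.Mult semiring using (×-homo-+; ×1-homo-*; ×-congˡ) renaming (_×_ to _×′_)
  open import Relation.Binary.Reasoning.Setoid setoid

  ⟦_⟧ℤ : ℤ → Carrier
  ⟦ + n ⟧ℤ      = n ×′ 1#
  ⟦ -[1+ n ] ⟧ℤ = - (suc n ×′ 1#)

  ⟦_⟧ₛ : Sign → Carrier
  ⟦ Sign.+ ⟧ₛ = 1#
  ⟦ Sign.- ⟧ₛ = - 1#

  ⟦◃⟧ : ∀ s n → ⟦ s ◃ n ⟧ℤ ≈ ⟦ s ⟧ₛ * (n ×′ 1#)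
  ⟦◃⟧ s      zero    = sym (zeroʳ _)
  ⟦◃⟧ Sign.+ (suc n) = sym (*-identityˡ _)
  ⟦◃⟧ Sign.- (suc n) = sym (-1*x≈-x _)

  ⟦sign⟧*⟦abs⟧ : ∀ i → ⟦ i ⟧ℤ ≈ ⟦ sign i ⟧ₛ * (∣ i ∣ ×′ 1#)
  ⟦sign⟧*⟦abs⟧ (+ n)      = sym (*-identityˡ _)
  ⟦sign⟧*⟦abs⟧ -[1+ n ]   = sym (-1*x≈-x _)

  ⟦⟧ₛ-homo-* : ∀ s t → ⟦ s Sign.* t ⟧ₛ ≈ ⟦ s ⟧ₛ * ⟦ t ⟧ₛ
  ⟦⟧ₛ-homo-* Sign.+ t      = sym (*-identityˡ _)
  ⟦⟧ₛ-homo-* Sign.- Sign.+ = sym (*-identityʳ _)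
  ⟦⟧ₛ-homo-* Sign.- Sign.- = sym (trans (-1*x≈-x _) (-‿involutive _))

  ⟦⟧ℤ-homo-* : ∀ i j → ⟦ i ℤ.* j ⟧ℤ ≈ ⟦ i ⟧ℤ * ⟦ j ⟧ℤ
  ⟦⟧ℤ-homo-* i j = begin
    ⟦ (sign i Sign.* sign j) ◃ (∣ i ∣ ℕ.* ∣ j ∣) ⟧ℤ            ≈⟨ ⟦◃⟧ (sign i Sign.* sign j) (∣ i ∣ ℕ.* ∣ j ∣) ⟩
    ⟦ sign i Sign.* sign j ⟧ₛ * ((∣ i ∣ ℕ.* ∣ j ∣) ×′ 1#)       ≈⟨ *-cong (⟦⟧ₛ-homo-* (sign i) (sign j)) (×1-homo-* ∣ i ∣ ∣ j ∣) ⟩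
    (⟦ sign i ⟧ₛ * ⟦ sign j ⟧ₛ) * ((∣ i ∣ ×′ 1#) * (∣ j ∣ ×′ 1#)) ≈⟨ *-interchange _ _ _ _ ⟩
    (⟦ sign i ⟧ₛ * (∣ i ∣ ×′ 1#)) * (⟦ sign j ⟧ₛ * (∣ j ∣ ×′ 1#)) ≈⟨ *-cong (⟦sign⟧*⟦abs⟧ i) (⟦sign⟧*⟦abs⟧ j) ⟨
    ⟦ i ⟧ℤ * ⟦ j ⟧ℤ                                             ∎
    where open import Algebra.Properties.CommutativeSemigroup *-commutativeSemigroup
            using () renaming (interchange to *-interchange)

  ⟦⊖⟧ : ∀ m n → ⟦ m ⊖ n ⟧ℤ ≈ m ×′ 1# - n ×′ 1#
  ⟦⊖⟧ m       zero    = trans (sym (+-identityʳ _)) (+-congˡ (sym -0#≈0#))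
  ⟦⊖⟧ zero    (suc n) = sym (+-identityˡ _)
  ⟦⊖⟧ (suc m) (suc n) rewrite [1+m]⊖[1+n]≡m⊖n m n = begin
    ⟦ m ⊖ n ⟧ℤ                            ≈⟨ ⟦⊖⟧ m n ⟩
    a - b                                 ≈⟨ +-identityˡ _ ⟨
    0# + (a - b)                          ≈⟨ +-congʳ (-‿inverseʳ 1#) ⟨
    (1# - 1#) + (a - b)                   ≈⟨ interchange _ _ _ _ ⟨
    (1# + a) + (- 1# + - b)               ≈⟨ +-congˡ (trans (-‿anti-homo-+ 1# b) (+-comm _ _)) ⟨
    (1# + a) - (1# + b)                   ∎
    where a = m ×′ 1#; b = n ×′ 1#

  ⟦⟧ℤ-homo-+ : ∀ i j → ⟦ i ℤ.+ j ⟧ℤ ≈ ⟦ i ⟧ℤ + ⟦ j ⟧ℤ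
  ⟦⟧ℤ-homo-+ (+ m)    (+ n)    = ×-homo-+ 1# m n
  ⟦⟧ℤ-homo-+ (+ m)    -[1+ n ] = ⟦⊖⟧ m (suc n)
  ⟦⟧ℤ-homo-+ -[1+ m ] (+ n)    = trans (⟦⊖⟧ n (suc m)) (+-comm _ _)
  ⟦⟧ℤ-homo-+ -[1+ m ] -[1+ n ] = begin
    - (suc (suc (m ℕ.+ n)) ×′ 1#)           ≈⟨ -‿cong (×-congˡ (≡.sym (+-suc (suc m) n))) ⟩
    - ((suc m ℕ.+ suc n) ×′ 1#)             ≈⟨ -‿cong (×-homo-+ 1# (suc m) (suc n)) ⟩
    - (suc m ×′ 1# + suc n ×′ 1#)            ≈⟨ -‿cong (+-comm _ _) ⟩
    - (suc n ×′ 1# + suc m ×′ 1#)            ≈⟨ -‿anti-homo-+ _ _ ⟩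
    - (suc m ×′ 1#) + - (suc n ×′ 1#)        ∎

  ⟦⟧ℤ-homo-‿ : ∀ i → ⟦ ℤ.- i ⟧ℤ ≈ - ⟦ i ⟧ℤ
  ⟦⟧ℤ-homo-‿ (+ zero)  = sym -0#≈0#
  ⟦⟧ℤ-homo-‿ (+ suc n) = refl
  ⟦⟧ℤ-homo-‿ -[1+ n ]  = sym (-‿involutive _)

  ℤ⟶R : ℤ.+-*-rawRing -Raw-AlmostCommutative⟶ fromCommutativeRing R
  ℤ⟶R = record
    { ⟦_⟧    = ⟦_⟧ℤ
    ; +-homo = ⟦⟧ℤ-homo-+
    ; *-homo = ⟦⟧ℤ-homo-*
    ; -‿homo = ⟦⟧ℤ-homo-‿
    ; 0-homo = refl
    ; 1-homo = +-identityʳ 1#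
    }

  _≟ℤ_ : ∀ i j → Maybe (⟦ i ⟧ℤ ≈ ⟦ j ⟧ℤ)
  i ≟ℤ j with i ℤ.≟ j
  ... | yes ≡.refl = just refl
  ... | no _       = nothing

  open RingSolver ℤ.+-*-rawRing (fromCommutativeRing R) ℤ⟶R _≟ℤ_ public


module PolynomialRing (k : NumberField) where
  open NumberField k hiding (zero)
  open PolyOver k
  open import Algebra.Properties.Ring ring using (-0#≈0#)

  -- A record rather than the Π-type `_≈ₚ_`, so that both polynomials can be inferred.
  infix 4 _≋_
  record _≋_ (p q : Poly) : Set where
    constructor mk≋
    field coeff-≈ : p ≈ₚ q
  open _≋_ public

  ≋-refl : ∀ {p} → p ≋ p
  ≋-refl = mk≋ λ _ → refl

  ≋-sym : ∀ {p q} → p ≋ q → q ≋ p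
  ≋-sym (mk≋ p≈q) = mk≋ λ i → sym (p≈q i)

  ≋-trans : ∀ {p q r} → p ≋ q → q ≋ r → p ≋ r
  ≋-trans (mk≋ p≈q) (mk≋ q≈r) = mk≋ λ i → trans (p≈q i) (q≈r i)

  ∷-cong : ∀ {x y p q} → x ≈ y → p ≋ q → x ∷ p ≋ y ∷ q
  ∷-cong x≈y (mk≋ p≈q) = mk≋ λ { zero → x≈y ; (suc i) → p≈q i }

  ∷-injective : ∀ {x y p q} → x ∷ p ≋ y ∷ q → x ≈ y × p ≋ q
  ∷-injective (mk≋ h) = h zero , mk≋ λ i → h (suc i)

  ∷≋0-injective : ∀ {x p} → x ∷ p ≋ 0ₚ → x ≈ 0# × p ≋ 0ₚ
  ∷≋0-injective (mk≋ h) = h zero , mk≋ λ i → h (suc i)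

  0∷-≋0 : ∀ {p} → p ≋ 0ₚ → 0# ∷ p ≋ 0ₚ
  0∷-≋0 (mk≋ h) = mk≋ λ { zero → refl ; (suc i) → h i }

  coeff-+ : ∀ p q i → coeff (p +ₚ q) i ≈ coeff p i + coeff q i
  coeff-+ []      q       i       = sym (+-identityˡ _)
  coeff-+ (x ∷ p) []      i       = sym (+-identityʳ _)
  coeff-+ (x ∷ p) (y ∷ q) zero    = refl
  coeff-+ (x ∷ p) (y ∷ q) (suc i) = coeff-+ p q i

  coeff-‿ : ∀ p i → coeff (-ₚ p) i ≈ - coeff p i
  coeff-‿ []      i       = sym -0#≈0#
  coeff-‿ (x ∷ p) zero    = refl
  coeff-‿ (x ∷ p) (suc i) = coeff-‿ p i

  coeff-· : ∀ c p i → coeff (c ·ₚ p) i ≈ c * coeff p i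
  coeff-· c []      i       = sym (zeroʳ c)
  coeff-· c (x ∷ p) zero    = refl
  coeff-· c (x ∷ p) (suc i) = coeff-· c p i

  +ₚ-cong : ∀ {p p′ q q′} → p ≋ p′ → q ≋ q′ → p +ₚ q ≋ p′ +ₚ q′
  +ₚ-cong {p} {p′} {q} {q′} (mk≋ p≈p′) (mk≋ q≈q′) = mk≋ λ i →
    trans (coeff-+ p q i) (trans (+-cong (p≈p′ i) (q≈q′ i)) (sym (coeff-+ p′ q′ i)))

  -ₚ-cong : ∀ {p q} → p ≋ q → -ₚ p ≋ -ₚ q
  -ₚ-cong {p} {q} (mk≋ p≈q) = mk≋ λ i →
    trans (coeff-‿ p i) (trans (-‿cong (p≈q i)) (sym (coeff-‿ q i)))

  +ₚ-assoc : ∀ p q r → (p +ₚ q) +ₚ r ≋ p +ₚ (q +ₚ r)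
  +ₚ-assoc []      q       r       = ≋-refl
  +ₚ-assoc (x ∷ p) []      r       = ≋-refl
  +ₚ-assoc (x ∷ p) (y ∷ q) []      = ≋-refl
  +ₚ-assoc (x ∷ p) (y ∷ q) (z ∷ r) = ∷-cong (+-assoc x y z) (+ₚ-assoc p q r)

  +ₚ-comm : ∀ p q → p +ₚ q ≋ q +ₚ p
  +ₚ-comm []      []      = ≋-refl
  +ₚ-comm []      (y ∷ q) = ≋-refl
  +ₚ-comm (x ∷ p) []      = ≋-refl
  +ₚ-comm (x ∷ p) (y ∷ q) = ∷-cong (+-comm x y) (+ₚ-comm p q)

  +ₚ-identityʳ : ∀ p → p +ₚ 0ₚ ≋ p
  +ₚ-identityʳ []      = ≋-refl
  +ₚ-identityʳ (x ∷ p) = ≋-refl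

  +ₚ-inverseʳ : ∀ p → p +ₚ (-ₚ p) ≋ 0ₚ
  +ₚ-inverseʳ []      = ≋-refl
  +ₚ-inverseʳ (x ∷ p) = ≋-trans (∷-cong (-‿inverseʳ x) (+ₚ-inverseʳ p)) (0∷-≋0 ≋-refl)

  +ₚ-abelianGroup : AbelianGroup 0ℓ 0ℓ
  +ₚ-abelianGroup = record
    { Carrier = Poly ; _≈_ = _≋_ ; _∙_ = _+ₚ_ ; ε = 0ₚ ; _⁻¹ = -ₚ_
    ; isAbelianGroup = record
      { isGroup = record
        { isMonoid = record
          { isSemigroup = record
            { isMagma = record
              { isEquivalence = record { refl = ≋-refl ; sym = ≋-sym ; trans = ≋-trans }
              ; ∙-cong = +ₚ-cong }
            ; assoc = +ₚ-assoc }
          ; identity = (λ _ → ≋-refl) , +ₚ-identityʳ }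
        ; inverse = (λ p → ≋-trans (+ₚ-comm (-ₚ p) p) (+ₚ-inverseʳ p)) , +ₚ-inverseʳ
        ; ⁻¹-cong = -ₚ-cong }
      ; comm = +ₚ-comm } }

  open import Algebra.Properties.CommutativeSemigroup (AbelianGroup.commutativeSemigroup +ₚ-abelianGroup)
    using () renaming (interchange to +ₚ-interchange; x∙yz≈y∙xz to +ₚ-left-comm)

  ·ₚ-congʳ : ∀ {c d} → c ≈ d → ∀ p → c ·ₚ p ≋ d ·ₚ p
  ·ₚ-congʳ c≈d []      = ≋-refl
  ·ₚ-congʳ c≈d (x ∷ p) = ∷-cong (*-congʳ c≈d) (·ₚ-congʳ c≈d p)

  ·ₚ-congˡ : ∀ c {p q} → p ≋ q → c ·ₚ p ≋ c ·ₚ q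
  ·ₚ-congˡ c {p} {q} (mk≋ p≈q) = mk≋ λ i →
    trans (coeff-· c p i) (trans (*-congˡ (p≈q i)) (sym (coeff-· c q i)))

  ·ₚ-zeroˡ : ∀ p → 0# ·ₚ p ≋ 0ₚ
  ·ₚ-zeroˡ []      = ≋-refl
  ·ₚ-zeroˡ (x ∷ p) = ≋-trans (∷-cong (zeroˡ x) (·ₚ-zeroˡ p)) (0∷-≋0 ≋-refl)

  ·ₚ-identityˡ : ∀ p → 1# ·ₚ p ≋ p
  ·ₚ-identityˡ []      = ≋-refl
  ·ₚ-identityˡ (x ∷ p) = ∷-cong (*-identityˡ x) (·ₚ-identityˡ p)

  ·ₚ-assoc : ∀ c d p → (c * d) ·ₚ p ≋ c ·ₚ (d ·ₚ p)
  ·ₚ-assoc c d []      = ≋-refl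
  ·ₚ-assoc c d (x ∷ p) = ∷-cong (*-assoc c d x) (·ₚ-assoc c d p)

  ·ₚ-distribʳ : ∀ c d p → (c + d) ·ₚ p ≋ c ·ₚ p +ₚ d ·ₚ p
  ·ₚ-distribʳ c d []      = ≋-refl
  ·ₚ-distribʳ c d (x ∷ p) = ∷-cong (distribʳ x c d) (·ₚ-distribʳ c d p)

  ·ₚ-distribˡ : ∀ c p q → c ·ₚ (p +ₚ q) ≋ c ·ₚ p +ₚ c ·ₚ q
  ·ₚ-distribˡ c []      q       = ≋-refl
  ·ₚ-distribˡ c (x ∷ p) []      = ≋-refl
  ·ₚ-distribˡ c (x ∷ p) (y ∷ q) = ∷-cong (distribˡ c x y) (·ₚ-distribˡ c p q)

  ·ₚ-0∷ : ∀ c p → c ·ₚ (0# ∷ p) ≋ 0# ∷ (c ·ₚ p)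
  ·ₚ-0∷ c p = ∷-cong (zeroʳ c) ≋-refl

  ≋0⇒*ₚ≋0 : ∀ {p} q → p ≋ 0ₚ → p *ₚ q ≋ 0ₚ
  ≋0⇒*ₚ≋0 {[]}    q p≋0 = ≋-refl
  ≋0⇒*ₚ≋0 {x ∷ p} q x∷p≋0 with ∷≋0-injective x∷p≋0
  ... | x≈0 , p≋0 = +ₚ-cong (≋-trans (·ₚ-congʳ x≈0 q) (·ₚ-zeroˡ q)) (0∷-≋0 (≋0⇒*ₚ≋0 q p≋0))

  *ₚ-congʳ : ∀ {p p′} q → p ≋ p′ → p *ₚ q ≋ p′ *ₚ q
  *ₚ-congʳ {[]}    {[]}     q p≋p′ = ≋-refl
  *ₚ-congʳ {[]}    {y ∷ p′} q p≋p′ = ≋-sym (≋0⇒*ₚ≋0 q (≋-sym p≋p′))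
  *ₚ-congʳ {x ∷ p} {[]}     q p≋p′ = ≋0⇒*ₚ≋0 q p≋p′
  *ₚ-congʳ {x ∷ p} {y ∷ p′} q x∷p≋y∷p′ with ∷-injective x∷p≋y∷p′
  ... | x≈y , p≋p′ = +ₚ-cong (·ₚ-congʳ x≈y q) (∷-cong refl (*ₚ-congʳ q p≋p′))

  *ₚ-congˡ : ∀ p {q q′} → q ≋ q′ → p *ₚ q ≋ p *ₚ q′
  *ₚ-congˡ []      q≋q′ = ≋-refl
  *ₚ-congˡ (x ∷ p) q≋q′ = +ₚ-cong (·ₚ-congˡ x q≋q′) (∷-cong refl (*ₚ-congˡ p q≋q′))

  *ₚ-distribʳ : ∀ p q r → (p +ₚ q) *ₚ r ≋ p *ₚ r +ₚ q *ₚ r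
  *ₚ-distribʳ []      q       r = ≋-refl
  *ₚ-distribʳ (x ∷ p) []      r = ≋-sym (+ₚ-identityʳ _)
  *ₚ-distribʳ (x ∷ p) (y ∷ q) r = ≋-trans
    (+ₚ-cong (·ₚ-distribʳ x y r) (∷-cong (sym (+-identityˡ 0#)) (*ₚ-distribʳ p q r)))
    (+ₚ-interchange (x ·ₚ r) (y ·ₚ r) (0# ∷ (p *ₚ r)) (0# ∷ (q *ₚ r)))

  ·ₚ-*ₚ-assoc : ∀ c p q → (c ·ₚ p) *ₚ q ≋ c ·ₚ (p *ₚ q)
  ·ₚ-*ₚ-assoc c []      q = ≋-refl
  ·ₚ-*ₚ-assoc c (x ∷ p) q = ≋-trans
    (+ₚ-cong (·ₚ-assoc c x q) (≋-trans (∷-cong refl (·ₚ-*ₚ-assoc c p q)) (≋-sym (·ₚ-0∷ c (p *ₚ q)))))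
    (≋-sym (·ₚ-distribˡ c (x ·ₚ q) (0# ∷ (p *ₚ q))))

  0∷-*ₚ : ∀ p q → (0# ∷ p) *ₚ q ≋ 0# ∷ (p *ₚ q)
  0∷-*ₚ p q = +ₚ-cong (·ₚ-zeroˡ q) ≋-refl

  *ₚ-assoc : ∀ p q r → (p *ₚ q) *ₚ r ≋ p *ₚ (q *ₚ r)
  *ₚ-assoc []      q r = ≋-refl
  *ₚ-assoc (x ∷ p) q r = ≋-trans (*ₚ-distribʳ (x ·ₚ q) (0# ∷ (p *ₚ q)) r)
    (+ₚ-cong (·ₚ-*ₚ-assoc x q r) (≋-trans (0∷-*ₚ (p *ₚ q) r) (∷-cong refl (*ₚ-assoc p q r))))

  *ₚ-zeroʳ : ∀ p → p *ₚ 0ₚ ≋ 0ₚ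
  *ₚ-zeroʳ []      = ≋-refl
  *ₚ-zeroʳ (x ∷ p) = 0∷-≋0 (*ₚ-zeroʳ p)

  *ₚ-∷ʳ : ∀ p y q → p *ₚ (y ∷ q) ≋ y ·ₚ p +ₚ (0# ∷ (p *ₚ q))
  *ₚ-∷ʳ []      y q = ≋-sym (0∷-≋0 ≋-refl)
  *ₚ-∷ʳ (x ∷ p) y q = ∷-cong (+-congʳ (*-comm x y)) (≋-trans
    (+ₚ-cong (≋-refl {x ·ₚ q}) (*ₚ-∷ʳ p y q))
    (+ₚ-left-comm (x ·ₚ q) (y ·ₚ p) (0# ∷ (p *ₚ q))))

  *ₚ-comm : ∀ p q → p *ₚ q ≋ q *ₚ p
  *ₚ-comm []      q = ≋-sym (*ₚ-zeroʳ q)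
  *ₚ-comm (x ∷ p) q = ≋-trans (+ₚ-cong ≋-refl (∷-cong refl (*ₚ-comm p q))) (≋-sym (*ₚ-∷ʳ q x p))

  *ₚ-identityˡ : ∀ p → 1ₚ *ₚ p ≋ p
  *ₚ-identityˡ p = ≋-trans (+ₚ-cong (·ₚ-identityˡ p) (0∷-≋0 ≋-refl)) (+ₚ-identityʳ p)

  polyRing : CommutativeRing 0ℓ 0ℓ
  polyRing = record
    { Carrier = Poly ; _≈_ = _≋_ ; _+_ = _+ₚ_ ; _*_ = _*ₚ_ ; -_ = -ₚ_ ; 0# = 0ₚ ; 1# = 1ₚ
    ; isCommutativeRing = record
      { isRing = record
        { +-isAbelianGroup = AbelianGroup.isAbelianGroup +ₚ-abelianGroup
        ; *-cong = λ {p} {p′} {q} {q′} p≋p′ q≋q′ → ≋-trans (*ₚ-congʳ q p≋p′) (*ₚ-congˡ p′ q≋q′)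
        ; *-assoc = *ₚ-assoc
        ; *-identity = *ₚ-identityˡ , λ p → ≋-trans (*ₚ-comm p 1ₚ) (*ₚ-identityˡ p)
        ; distrib = (λ p q r → ≋-trans (*ₚ-comm p (q +ₚ r))
                      (≋-trans (*ₚ-distribʳ q r p) (+ₚ-cong (*ₚ-comm q p) (*ₚ-comm r p))))
                  , (λ p q r → *ₚ-distribʳ q r p) }
      ; *-comm = *ₚ-comm } }


module Degree (k : NumberField) where
  open NumberField k hiding (zero)
  open PolyOver k
  open PolynomialRing k
  open import Algebra.Properties.Ring ring using (x+x≈x⇒x≈0; -0#≈0#; -‿injective)

  sumF-zero : ∀ n (f : Fin n → Carrier) → (∀ i → f i ≈ 0#) → sumF baseRing n f ≈ 0#
  sumF-zero zero    f f≈0 = refl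
  sumF-zero (suc n) f f≈0 = trans (+-cong (f≈0 _) (sumF-zero n _ λ i → f≈0 _)) (+-identityˡ 0#)

  ι-0 : ι ℚ.0ℚ ≈ 0#
  ι-0 = x+x≈x⇒x≈0 _ (trans (sym (ι-+ ℚ.0ℚ ℚ.0ℚ)) (reflexive (cong ι (ℚ.+-identityʳ ℚ.0ℚ))))

  -- Zero-testing in k reduces to zero-testing of the rational coordinates in the basis.
  isZero? : ∀ x → Dec (x ≈ 0#)
  isZero? x with span x
  ... | c , x≈∑ with all? (λ i → c i ℚ.≟ ℚ.0ℚ)
  ...   | yes c≡0 = yes (trans x≈∑ (sumF-zero dim _ λ i →
                      trans (*-congʳ (trans (reflexive (cong ι (c≡0 i))) ι-0)) (zeroˡ _)))
  ...   | no  c≢0 = no λ x≈0 → c≢0 (indep c (trans (sym x≈∑) x≈0))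

  x≉0∧y≉0⇒x*y≉0 : ∀ {x y} → ¬ x ≈ 0# → ¬ y ≈ 0# → ¬ x * y ≈ 0#
  x≉0∧y≉0⇒x*y≉0 {x} {y} x≉0 y≉0 xy≈0 with inv x x≉0
  ... | x⁻¹ , xx⁻¹≈1 = y≉0 (begin
    y               ≈⟨ *-identityˡ y ⟨
    1# * y          ≈⟨ *-congʳ xx⁻¹≈1 ⟨
    (x * x⁻¹) * y   ≈⟨ *-assoc x x⁻¹ y ⟩
    x * (x⁻¹ * y)   ≈⟨ *-congˡ (*-comm x⁻¹ y) ⟩
    x * (y * x⁻¹)   ≈⟨ *-assoc x y x⁻¹ ⟨
    (x * y) * x⁻¹   ≈⟨ *-congʳ xy≈0 ⟩
    0# * x⁻¹        ≈⟨ zeroˡ x⁻¹ ⟩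
    0#              ∎)
    where open import Relation.Binary.Reasoning.Setoid setoid

  ≋0⊎Deg : ∀ p → p ≋ 0ₚ ⊎ ∃[ d ] Deg p d
  ≋0⊎Deg []      = inj₁ ≋-refl
  ≋0⊎Deg (x ∷ p) with ≋0⊎Deg p
  ... | inj₂ (d , l , lead , l≉0 , above) =
    inj₂ (suc d , l , lead , l≉0 , λ { (suc i) (s≤s d<i) → above i d<i })
  ... | inj₁ p≋0 with isZero? x
  ...   | yes x≈0 = inj₁ (≋-trans (∷-cong x≈0 p≋0) (0∷-≋0 ≋-refl))
  ...   | no  x≉0 = inj₂ (0 , x , refl , x≉0 , λ { (suc i) _ → coeff-≈ p≋0 i })

  HasLead-resp-≋ : ∀ {p q d l} → p ≋ q → HasLead p d l → HasLead q d l
  HasLead-resp-≋ {d = d} (mk≋ p≈q) (lead , l≉0 , above) =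
    trans (sym (p≈q d)) lead , l≉0 , λ i d<i → trans (sym (p≈q i)) (above i d<i)

  HasLead-resp-≈ : ∀ {p d l m} → l ≈ m → HasLead p d l → HasLead p d m
  HasLead-resp-≈ l≈m (lead , l≉0 , above) = trans lead l≈m , (λ m≈0 → l≉0 (trans l≈m m≈0)) , above

  HasLead⇒≉0 : ∀ {p d l} → HasLead p d l → ¬ p ≋ 0ₚ
  HasLead⇒≉0 {d = d} (lead , l≉0 , _) (mk≋ p≈0) = l≉0 (trans (sym lead) (p≈0 d))

  HasLead-deg-unique : ∀ {p d e l m} → HasLead p d l → HasLead p e m → d ≡ e
  HasLead-deg-unique {d = d} {e} (lead , l≉0 , above) (lead′ , m≉0 , above′) with <-cmp d e
  ... | tri< d<e _ _ = ⊥-elim (m≉0 (trans (sym lead′) (above e d<e)))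
  ... | tri≈ _ d≡e _ = d≡e
  ... | tri> _ _ e<d = ⊥-elim (l≉0 (trans (sym lead) (above′ d e<d)))

  HasLead-+ₚˡ : ∀ {p q e m} → (∀ i → e ≤ i → coeff p i ≈ 0#) → HasLead q e m → HasLead (p +ₚ q) e m
  HasLead-+ₚˡ {p} {q} {e} p≈0 (lead , m≉0 , above) =
    trans (coeff-+ p q e) (trans (+-cong (p≈0 e ≤-refl) lead) (+-identityˡ _)) , m≉0 ,
    λ i e<i → trans (coeff-+ p q i) (trans (+-cong (p≈0 i (<⇒≤ e<i)) (above i e<i)) (+-identityˡ 0#))

  HasLead-0∷ : ∀ {p d l} → HasLead p d l → HasLead (0# ∷ p) (suc d) l
  HasLead-0∷ (lead , l≉0 , above) = lead , l≉0 , λ { (suc i) (s≤s d<i) → above i d<i }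

  HasLead-+ₚʳ : ∀ {p q e m} → HasLead p e m → (∀ i → e ≤ i → coeff q i ≈ 0#) → HasLead (p +ₚ q) e m
  HasLead-+ₚʳ {p} {q} hp q≈0 = HasLead-resp-≋ (+ₚ-comm q p) (HasLead-+ₚˡ {q} {p} q≈0 hp)

  HasLead-‿ : ∀ {p d l} → HasLead p d l → HasLead (-ₚ p) d (- l)
  HasLead-‿ {p} {d} (lead , l≉0 , above) =
    trans (coeff-‿ p d) (-‿cong lead) ,
    (λ -l≈0 → l≉0 (-‿injective (trans -l≈0 (sym -0#≈0#)))) ,
    λ i d<i → trans (coeff-‿ p i) (trans (-‿cong (above i d<i)) -0#≈0#)

  HasLead-· : ∀ {c p d l} → ¬ c ≈ 0# → HasLead p d l → HasLead (c ·ₚ p) d (c * l)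
  HasLead-· {c} {p} {d} c≉0 (lead , l≉0 , above) =
    trans (coeff-· c p d) (*-congˡ lead) , x≉0∧y≉0⇒x*y≉0 c≉0 l≉0 ,
    λ i d<i → trans (coeff-· c p i) (trans (*-congˡ (above i d<i)) (zeroʳ c))

  HasLead-*ₚ : ∀ {p q d e l m} → HasLead p d l → HasLead q e m → HasLead (p *ₚ q) (d ℕ.+ e) (l * m)
  HasLead-*ₚ {[]} (lead , l≉0 , _) _ = ⊥-elim (l≉0 (sym lead))
  HasLead-*ₚ {x ∷ p} {q} {zero} (x≈l , l≉0 , above) hq =
    HasLead-+ₚʳ {x ·ₚ q} (HasLead-resp-≈ {x ·ₚ q} (*-congʳ x≈l) (HasLead-· {p = q} x≉0 hq)) (λ i _ → coeff-≈ 0∷pq≋0 i)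
    where
    x≉0 : ¬ x ≈ 0#
    x≉0 x≈0 = l≉0 (trans (sym x≈l) x≈0)
    0∷pq≋0 : 0# ∷ (p *ₚ q) ≋ 0ₚ
    0∷pq≋0 = 0∷-≋0 (≋0⇒*ₚ≋0 {p} q (mk≋ λ i → above (suc i) (s≤s z≤n)))
  HasLead-*ₚ {x ∷ p} {q} {suc d} {e} {l} (lead , l≉0 , above) hq@(_ , _ , aboveq) =
    HasLead-+ₚˡ {x ·ₚ q} x·q-vanishes (HasLead-0∷ {p *ₚ q} (HasLead-*ₚ {p} {q} hp hq))
    where
    hp : HasLead p d l
    hp = lead , l≉0 , λ i d<i → above (suc i) (s≤s d<i)
    x·q-vanishes : ∀ i → suc (d ℕ.+ e) ≤ i → coeff (x ·ₚ q) i ≈ 0#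
    x·q-vanishes i d+e<i =
      trans (coeff-· x q i) (trans (*-congˡ (aboveq i (<-≤-trans (s≤s (m≤n+m e d)) d+e<i))) (zeroʳ x))

  p≉0∧p*q≋0⇒q≋0 : ∀ {p q} → ¬ p ≋ 0ₚ → p *ₚ q ≋ 0ₚ → q ≋ 0ₚ
  p≉0∧p*q≋0⇒q≋0 {p} {q} p≉0 pq≋0 with ≋0⊎Deg p | ≋0⊎Deg q
  ... | inj₁ p≋0          | _                 = ⊥-elim (p≉0 p≋0)
  ... | _                 | inj₁ q≋0          = q≋0
  ... | inj₂ (_ , _ , hp) | inj₂ (_ , _ , hq) = ⊥-elim (HasLead⇒≉0 {p *ₚ q} (HasLead-*ₚ {p} {q} hp hq) pq≋0)

module Positivity (k : NumberField) where
  open NumberField k hiding (zero)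
  open PolyOver k
  open PolynomialRing k
  open Degree k
  open import Algebra.Properties.Ring ring using (-‿distribˡ-*; -‿distribʳ-*; -‿involutive)
  open import Algebra.Properties.CommutativeSemigroup *-commutativeSemigroup using (interchange)
  open import Relation.Binary.Reasoning.Setoid setoid
  open IntegerCoefficientSolver baseRing using (solve; _:=_; _:*_)

  negPow-+ : ∀ d e → negPow (d ℕ.+ e) ≈ negPow d * negPow e
  negPow-+ zero    e = sym (*-identityˡ _)
  negPow-+ (suc d) e = trans (-‿cong (negPow-+ d e)) (-‿distribˡ-* _ _)

  negPow-square : ∀ d → negPow d * negPow d ≈ 1#
  negPow-square zero    = *-identityˡ 1#
  negPow-square (suc d) = begin
    - negPow d * - negPow d     ≈⟨ -‿distribˡ-* _ _ ⟨
    - (negPow d * - negPow d)   ≈⟨ -‿cong (-‿distribʳ-* _ _) ⟨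
    - - (negPow d * negPow d)   ≈⟨ -‿involutive _ ⟩
    negPow d * negPow d         ≈⟨ negPow-square d ⟩
    1#                          ∎

  negPow≉0 : ∀ d → ¬ negPow d ≈ 0#
  negPow≉0 d ε≈0 = 0≉1 (trans (sym (trans (*-congʳ ε≈0) (zeroˡ _))) (negPow-square d))

  IsNonzeroSquare-resp-≈ : ∀ {a b} → a ≈ b → IsNonzeroSquare a → IsNonzeroSquare b
  IsNonzeroSquare-resp-≈ a≈b (u , u≉0 , uu≈a) = u , u≉0 , trans uu≈a a≈b

  IsNonzeroSquare-* : ∀ {a b} → IsNonzeroSquare a → IsNonzeroSquare b → IsNonzeroSquare (a * b)
  IsNonzeroSquare-* (u , u≉0 , uu≈a) (v , v≉0 , vv≈b) =
    u * v , x≉0∧y≉0⇒x*y≉0 u≉0 v≉0 , trans (interchange u v u v) (*-cong uu≈a vv≈b)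

  IsNonzeroSquare-cancelˡ : ∀ {a b} → IsNonzeroSquare a → IsNonzeroSquare (a * b) → IsNonzeroSquare b
  IsNonzeroSquare-cancelˡ {a} {b} (u , u≉0 , uu≈a) (w , w≉0 , ww≈ab) with inv u u≉0
  ... | v , uv≈1 = v * w , x≉0∧y≉0⇒x*y≉0 v≉0 w≉0 , (begin
    (v * w) * (v * w)         ≈⟨ interchange v w v w ⟩
    (v * v) * (w * w)         ≈⟨ *-congˡ (trans ww≈ab (*-congʳ (sym uu≈a))) ⟩
    (v * v) * ((u * u) * b)   ≈⟨ solve 3 (λ u v b → v :* v :* (u :* u :* b) := (u :* v) :* (u :* v) :* b)
                                        refl u v b ⟩
    ((u * v) * (u * v)) * b   ≈⟨ *-congʳ (trans (*-cong uv≈1 uv≈1) (*-identityˡ 1#)) ⟩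
    1# * b                    ≈⟨ *-identityˡ b ⟩
    b                         ∎)
    where
    v≉0 : ¬ v ≈ 0#
    v≉0 v≈0 = 0≉1 (trans (sym (trans (*-congˡ v≈0) (zeroʳ u))) uv≈1)

  record PositiveOfDegree (p : Poly) (d : ℕ) : Set where
    constructor positiveOfDegree
    field
      {lead}             : Carrier
      hasLead            : HasLead p d lead
      signedLeadIsSquare : IsNonzeroSquare (negPow d * lead)

  PositiveOfDegree-resp-≋ : ∀ {p q d} → p ≋ q → PositiveOfDegree p d → PositiveOfDegree q d
  PositiveOfDegree-resp-≋ p≋q (positiveOfDegree hp sq) = positiveOfDegree (HasLead-resp-≋ p≋q hp) sq

  positive⇒positiveOfDegree : ∀ {p} → Positive p → ∃[ d ] PositiveOfDegree p d
  positive⇒positiveOfDegree {p} (_ , d , (l , hp) , _ , (lead′ , _) , sq) =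
    d , positiveOfDegree hp
          (IsNonzeroSquare-resp-≈ (trans (sym lead′) (trans (coeff-· (negPow d) p d) (*-congˡ (proj₁ hp)))) sq)

  positiveOfDegree⇒positive : ∀ {p d} → PositiveOfDegree p d → Positive p
  positiveOfDegree⇒positive {p} {d} (positiveOfDegree {l} hp sq) =
    (λ p≈0 → HasLead⇒≉0 {p} hp (mk≋ p≈0)) , d , (l , hp) , negPow d * l , HasLead-· {p = p} (negPow≉0 d) hp , sq

  square-positive : ∀ {p d l} → HasLead p d l → PositiveOfDegree (p *ₚ p) (d ℕ.+ d)
  square-positive {p} {d} {l} hp@(_ , l≉0 , _) =
    positiveOfDegree (HasLead-*ₚ {p} {p} hp hp)
      (IsNonzeroSquare-resp-≈ (trans (interchange _ _ _ _) (*-congʳ (sym (negPow-+ d d))))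
        (negPow d * l , x≉0∧y≉0⇒x*y≉0 (negPow≉0 d) l≉0 , refl))

  pos*pos⇒pos : ∀ {p q d e} → PositiveOfDegree p d → PositiveOfDegree q e → PositiveOfDegree (p *ₚ q) (d ℕ.+ e)
  pos*pos⇒pos {p} {q} {d} {e} (positiveOfDegree hp sp) (positiveOfDegree hq sq) =
    positiveOfDegree (HasLead-*ₚ {p} {q} hp hq)
      (IsNonzeroSquare-resp-≈ (trans (interchange _ _ _ _) (*-congʳ (sym (negPow-+ d e)))) (IsNonzeroSquare-* sp sq))

  pos-cancelˡ : ∀ {p q d f} → PositiveOfDegree p d → PositiveOfDegree (p *ₚ q) f → ∃[ e ] PositiveOfDegree q e
  pos-cancelˡ {p} {q} {d} (positiveOfDegree {l} hp sp) (positiveOfDegree {n} hpq spq) with ≋0⊎Deg q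
  ... | inj₁ q≋0 = ⊥-elim (HasLead⇒≉0 {p *ₚ q} hpq (≋-trans (*ₚ-congˡ p q≋0) (*ₚ-zeroʳ p)))
  ... | inj₂ (e , m , hq) with HasLead-deg-unique {p *ₚ q} hpq (HasLead-*ₚ {p} {q} hp hq)
  ...   | ≡.refl = e , positiveOfDegree hq (IsNonzeroSquare-cancelˡ sp (IsNonzeroSquare-resp-≈ signedLead spq))
    where
    signedLead : negPow (d ℕ.+ e) * n ≈ (negPow d * l) * (negPow e * m)
    signedLead = trans (*-cong (negPow-+ d e) (trans (sym (proj₁ hpq)) (proj₁ (HasLead-*ₚ {p} {q} hp hq))))
                       (interchange _ _ _ _)

  pos+pos⇒pos : ∀ {p q d e} → PositiveOfDegree p d → PositiveOfDegree q e → d ≢ e → ∃[ f ] PositiveOfDegree (p +ₚ q) f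
  pos+pos⇒pos {p} {q} {d} {e} (positiveOfDegree hp sp) (positiveOfDegree hq sq) d≢e with <-cmp d e
  ... | tri< d<e _ _ = e , positiveOfDegree (HasLead-+ₚˡ {p} (λ i e≤i → proj₂ (proj₂ hp) i (<-≤-trans d<e e≤i)) hq) sq
  ... | tri≈ _ d≡e _ = ⊥-elim (d≢e d≡e)
  ... | tri> _ _ e<d = d , positiveOfDegree (HasLead-+ₚʳ {p} hp (λ i d≤i → proj₂ (proj₂ hq) i (<-≤-trans e<d d≤i))) sp

  negative∧oddDegree⇒negation-positive : ∀ {D} → Negative D → OddDegree D →
    ∃[ m ] PositiveOfDegree (-ₚ D) (suc (2 ℕ.* m))
  negative∧oddDegree⇒negation-positive {D} D⁻ (_ , (_ , hD) , m , ≡.refl) with positive⇒positiveOfDegree D⁻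
  ... | _ , -D⁺@(positiveOfDegree h-D _) with HasLead-deg-unique { -ₚ D} h-D (HasLead-‿ {D} hD)
  ...   | ≡.refl = m , -D⁺

  Positive-resp-≋ : ∀ {p q} → p ≋ q → Positive p → Positive q
  Positive-resp-≋ p≋q p⁺ with positive⇒positiveOfDegree p⁺
  ... | _ , p⁺ᵈ = positiveOfDegree⇒positive (PositiveOfDegree-resp-≋ p≋q p⁺ᵈ)


even≢odd+even : ∀ f m e → f ℕ.+ f ≢ suc (2 ℕ.* m) ℕ.+ (e ℕ.+ e)
even≢odd+even f m e eq = even≢odd f (m ℕ.+ e) (≡.trans (double f) (≡.trans eq (odd+even m e)))
  where
  double : ∀ f → 2 ℕ.* f ≡ f ℕ.+ f
  double = solve-∀
  odd+even : ∀ m e → suc (2 ℕ.* m) ℕ.+ (e ℕ.+ e) ≡ suc (2 ℕ.* (m ℕ.+ e))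
  odd+even = solve-∀

module QuadraticForms (k : NumberField) where
  open NumberField k using (0≉1; sym; trans)
  open PolyOver k
  open PolynomialRing k
  open Degree k
  open Positivity k
  open CommutativeRing polyRing using (*-congʳ; *-cong; *-identityˡ; setoid)
  open import Relation.Binary.Reasoning.Setoid setoid
  open IntegerCoefficientSolver polyRing using (solve; _:=_; _:+_; _:*_; :-_; _:-_; con)

  -- `con (+ 2)` denotes 1ₚ +ₚ 1ₚ, which computes to twoₚ.
  a*eval≋completedSquare : ∀ a b c x y →
    a *ₚ eval (form a b c) x y ≋ (a *ₚ x +ₚ b *ₚ y) *ₚ (a *ₚ x +ₚ b *ₚ y) +ₚ (-ₚ disc (form a b c)) *ₚ (y *ₚ y)
  a*eval≋completedSquare = solve 5 (λ a b c x y →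
    a :* (a :* x :* x :+ con (+ 2) :* b :* x :* y :+ c :* y :* y)
      := (a :* x :+ b :* y) :* (a :* x :+ b :* y) :+ (:- (b :* b :- a :* c)) :* (y :* y)) ≋-refl

  disc-∣≋det²*disc : ∀ a b c m r n s det →
    disc (form a b c ∣ mat m r n s det) ≋ (m *ₚ s -ₚ r *ₚ n) *ₚ (m *ₚ s -ₚ r *ₚ n) *ₚ disc (form a b c)
  disc-∣≋det²*disc a b c m r n s _ = solve 7 (λ a b c m r n s →
    let B = a :* m :* n :+ b :* (m :* s :+ r :* n) :+ c :* r :* s
        Q : _ → _ → _
        Q x y = a :* x :* x :+ con (+ 2) :* b :* x :* y :+ c :* y :* y
    in B :* B :- Q m r :* Q n s := (m :* s :- r :* n) :* (m :* s :- r :* n) :* (b :* b :- a :* c))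
    ≋-refl a b c m r n s

  disc-∣ : ∀ Q M → disc (Q ∣ M) ≋ disc Q
  disc-∣ Q@(form a b c) (mat m r n s det) = begin
    disc (Q ∣ mat m r n s det)  ≈⟨ disc-∣≋det²*disc a b c m r n s det ⟩
    δ *ₚ δ *ₚ disc Q            ≈⟨ *-congʳ (*-cong δ≋1 δ≋1) ⟩
    1ₚ *ₚ 1ₚ *ₚ disc Q          ≈⟨ *-congʳ (*-identityˡ 1ₚ) ⟩
    1ₚ *ₚ disc Q                ≈⟨ *-identityˡ (disc Q) ⟩
    disc Q                      ∎
    where
    δ = m *ₚ s -ₚ r *ₚ n
    δ≋1 : δ ≋ 1ₚ
    δ≋1 = mk≋ det

  SL₂-firstColumn-nonzero : ∀ M → ¬ (SL₂.m M ≋ 0ₚ × SL₂.r M ≋ 0ₚ)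
  SL₂-firstColumn-nonzero (mat m r n s det) (m≋0 , r≋0) = 0≉1 (trans (sym (coeff-≈ δ≋0 0)) (det 0))
    where
    δ≋0 : m *ₚ s -ₚ r *ₚ n ≋ 0ₚ
    δ≋0 = +ₚ-cong (≋0⇒*ₚ≋0 s m≋0) (-ₚ-cong (≋0⇒*ₚ≋0 n r≋0))

  -- The zero polynomial divides both and is not a unit.
  coprime⇒nonzero : ∀ {x y} → Coprime x y → ¬ (x ≋ 0ₚ × y ≋ 0ₚ)
  coprime⇒nonzero cop (x≋0 , y≋0) with cop 0ₚ (0ₚ , λ i → sym (coeff-≈ x≋0 i)) (0ₚ , λ i → sym (coeff-≈ y≋0 i))
  ... | _ , 0≈1 = 0≉1 (0≈1 0)

  square+odd-positive : ∀ {N m} → PositiveOfDegree N (suc (2 ℕ.* m)) →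
    ∀ X y → ¬ (X ≋ 0ₚ × y ≋ 0ₚ) → ∃[ f ] PositiveOfDegree (X *ₚ X +ₚ N *ₚ (y *ₚ y)) f
  square+odd-positive {N} {m} N⁺ X y nonzero with ≋0⊎Deg X | ≋0⊎Deg y
  ... | inj₁ X≋0          | inj₁ y≋0          = ⊥-elim (nonzero (X≋0 , y≋0))
  ... | inj₂ (f , _ , hX) | inj₁ y≋0          =
    f ℕ.+ f , PositiveOfDegree-resp-≋ (≋-sym X²+Ny²≋X²) (square-positive {X} hX)
    where
    X²+Ny²≋X² : X *ₚ X +ₚ N *ₚ (y *ₚ y) ≋ X *ₚ X
    X²+Ny²≋X² = begin
      X *ₚ X +ₚ N *ₚ (y *ₚ y)   ≈⟨ +ₚ-cong (≋-refl {X *ₚ X}) (*ₚ-congˡ N (≋0⇒*ₚ≋0 y y≋0)) ⟩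
      X *ₚ X +ₚ N *ₚ 0ₚ         ≈⟨ +ₚ-cong (≋-refl {X *ₚ X}) (*ₚ-zeroʳ N) ⟩
      X *ₚ X +ₚ 0ₚ              ≈⟨ +ₚ-identityʳ (X *ₚ X) ⟩
      X *ₚ X                    ∎
  ... | inj₁ X≋0          | inj₂ (e , _ , hy) =
    _ , PositiveOfDegree-resp-≋ (+ₚ-cong (≋-sym (≋0⇒*ₚ≋0 X X≋0)) ≋-refl) (pos*pos⇒pos N⁺ (square-positive {y} hy))
  ... | inj₂ (f , _ , hX) | inj₂ (e , _ , hy) =
    pos+pos⇒pos (square-positive {X} hX) (pos*pos⇒pos N⁺ (square-positive {y} hy)) (even≢odd+even f m e)

  values-positive : ∀ D Q → In𝒬 D Q → Negative D → OddDegree D →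
    ∀ x y → ¬ (x ≋ 0ₚ × y ≋ 0ₚ) → Positive (eval Q x y)
  values-positive D Q@(form a b c) (disc≈D , a⁺) D⁻ D-odd x y nonzero
    with positive⇒positiveOfDegree a⁺ | negative∧oddDegree⇒negation-positive D⁻ D-odd
  ... | _ , a⁺ᵈ@(positiveOfDegree ha _) | m , -D⁺ =
    positiveOfDegree⇒positive {eval Q x y} (proj₂ (pos-cancelˡ {a} a⁺ᵈ a*Q⁺))
    where
    X = a *ₚ x +ₚ b *ₚ y
    a*Q≋X²-Dy² : a *ₚ eval Q x y ≋ X *ₚ X +ₚ (-ₚ D) *ₚ (y *ₚ y)
    a*Q≋X²-Dy² = ≋-trans (a*eval≋completedSquare a b c x y)
      (+ₚ-cong (≋-refl {X *ₚ X}) (*ₚ-congʳ (y *ₚ y) (-ₚ-cong (mk≋ {disc Q} {D} disc≈D))))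
    X,y-nonzero : ¬ (X ≋ 0ₚ × y ≋ 0ₚ)
    X,y-nonzero (X≋0 , y≋0) = nonzero (p≉0∧p*q≋0⇒q≋0 (HasLead⇒≉0 {a} ha) ax≋0 , y≋0)
      where
      ax≋0 : a *ₚ x ≋ 0ₚ
      ax≋0 = begin
        a *ₚ x                 ≈⟨ +ₚ-identityʳ (a *ₚ x) ⟨
        a *ₚ x +ₚ 0ₚ           ≈⟨ +ₚ-cong (≋-refl {a *ₚ x}) (*ₚ-zeroʳ b) ⟨
        a *ₚ x +ₚ b *ₚ 0ₚ      ≈⟨ +ₚ-cong (≋-refl {a *ₚ x}) (*ₚ-congˡ b y≋0) ⟨
        X                      ≈⟨ X≋0 ⟩
        0ₚ                     ∎
    a*Q⁺ = PositiveOfDegree-resp-≋ (≋-sym a*Q≋X²-Dy²)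
             (proj₂ (square+odd-positive { -ₚ D} {m} -D⁺ X y X,y-nonzero))


lemma5 : (k : NumberField) → let open PolyOver k in
    (D : Poly) → Negative D → SquareFree D → OddDegree D →
    (Q : Form) → In𝒬 D Q →
    ((M : SL₂) → In𝒬 D (Q ∣ M)) × ((n : Poly) → ProperlyRepresents Q n → Positive n)
lemma5 k D D⁻ _ D-odd Q@(PolyOver.form _ _ _) Q∈𝒬@(disc≈D , _) = Q∣M∈𝒬 , represented⇒positive
  where
  open PolyOver k
  open PolynomialRing k
  open Positivity k
  open QuadraticForms k

  Q∣M∈𝒬 : ∀ M → In𝒬 D (Q ∣ M)
  Q∣M∈𝒬 M@(mat m r _ _ _) =
    coeff-≈ (≋-trans (disc-∣ Q M) (mk≋ {disc Q} {D} disc≈D)) ,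
    values-positive D Q Q∈𝒬 D⁻ D-odd m r (SL₂-firstColumn-nonzero M)

  represented⇒positive : ∀ n → ProperlyRepresents Q n → Positive n
  represented⇒positive n (x , y , x⊥y , Qxy≈n) =
    Positive-resp-≋ (mk≋ {eval Q x y} {n} Qxy≈n) (values-positive D Q Q∈𝒬 D⁻ D-odd x y (coprime⇒nonzero x⊥y))
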